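{- Let $N=(S,A,T)$ be a P/T net with silent moves. For all markings $m_1,m_2$, if $m_1\approx_p m_2$ then $m_1\approx_{bri}m_2$.
   Context: A P/T net is $N=(S,A,T)$ with $S$ a finite set of places, $A$ a finite set of labels, and $T\subseteq(\mathcal{M}(S)\setminus\{\theta\})\times A\times\mathcal{M}(S)$ a finite set of transitions, where $\mathcal{M}(S)$ is the set of finite multisets over $S$ (markings) and $\theta$ the empty multiset; it has silent moves if $\tau\in A$. For $t=(m,\ell,m')$: ${}^\bullet t=m$, $l(t)=\ell$, $t^\bullet=m'$. $\oplus$ multiset union, $\ominus$ truncated difference, $\subseteq$ inclusion, $|m|$ size. $m[t\rangle m'$ iff ${}^\bullet t\subseteq m$ and $m'=(m\ominus{}^\bullet t)\oplus t^\bullet$; firing sequences $m[\sigma\rangle m'$ defined inductively; ${}^\bullet\epsilon=\theta$, ${}^\bullet(t\sigma)={}^\bullet t\oplus({}^\bullet\sigma\ominus t^\bullet)$, $\epsilon^\bullet=\theta$, $(t\sigma)^\bullet=\sigma^\bullet\oplus(t^\bullet\ominus{}^\bullet\sigma)$. The observable label $o(\sigma)$ of a sequence is defined by $o(\epsilon)=\epsilon$, $o(t\sigma)=l(t)o(\sigma)$ if $l(t)\ne\tau$ and $o(t\sigma)=o(\sigma)$ otherwise. Branching interleaving bisimulation: a relation $R\subseteq\mathcal{M}(S)\times\mathcal{M}(S)$ such that if $(m_1,m_2)\in R$ then for every $t_1$ with $m_1[t_1\rangle m_1'$, either $l(t_1)=\tau$ and there is $\sigma_2$ with $o(\sigma_2)=\epsilon$,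 $m_2[\sigma_2\rangle m_2'$, $(m_1,m_2')\in R$ and $(m_1',m_2')\in R$; or there are $\sigma,t_2$ with $o(\sigma)=\epsilon$, $l(t_1)=l(t_2)$, $m_2[\sigma\rangle m[t_2\rangle m_2'$, $(m_1,m)\in R$ and $(m_1',m_2')\in R$; and symmetrically for every $t_2$ with $m_2[t_2\rangle m_2'$ (either $l(t_2)=\tau$ and some $\sigma_1$ with $o(\sigma_1)=\epsilon$, $m_1[\sigma_1\rangle m_1'$, $(m_1',m_2)\in R$, $(m_1',m_2')\in R$; or some $\sigma,t_1$ with $o(\sigma)=\epsilon$, $l(t_1)=l(t_2)$, $m_1[\sigma\rangle m[t_1\rangle m_1'$, $(m,m_2)\in R$, $(m_1',m_2')\in R$). $m_1\approx_{bri}m_2$ iff some branching interleaving bisimulation contains $(m_1,m_2)$. $t$ is $\tau$-sequential if $l(t)=\tau$ and $|{}^\bullet t|=|t^\bullet|=1$. Idling transitions $i(s)=(s,\tau,s)$ ($s\in S$) form $I(S)$ and may appear in sequences. $\sigma=t_1\dots t_n$ ($n\ge1$, $t_i\in T\cup I(S)$) is $\tau$-1-sequential if each $t_i$ has label $\tau$, $|{}^\bullet t_i|=|t_i^\bullet|=1$ and $t_i^\bullet={}^\bullet t_{i+1}$; $\sigma=\sigma_1\dots\sigma_k$ is $\tau$-$k$-sequential if each $\sigma_i$ is $\tau$-1-sequential, ${}^\bullet\sigma=\bigoplus_i{}^\bullet\sigma_i$, $\sigma^\bullet=\bigoplus_i\sigma_i^\bullet$; $\tau$-sequential means $\tau$-$k$-sequential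 for some $k\ge1$. Additive closure $R^\oplus$ of $R\subseteq S\times S$: least relation on markings with $(\theta,\theta)\in R^\oplus$ and $(s_1\oplus m_1,s_2\oplus m_2)\in R^\oplus$ whenever $(s_1,s_2)\in R$ and $(m_1,m_2)\in R^\oplus$. For $\tau$-sequential $\sigma=t_1\dots t_n$ with ${}^\bullet\sigma=m_0[t_1\rangle m_1\cdots[t_n\rangle m_n=\sigma^\bullet$: $\Psi(m,\sigma,R^\oplus)$ iff $(m,m_i)\in R^\oplus$ for $i=0,\dots,n-1$; $\Phi(\sigma,m,R^\oplus)$ iff $(m_i,m)\in R^\oplus$ for $i=0,\dots,n-1$. A branching place bisimulation is $R\subseteq S\times S$ such that whenever $(m_1,m_2)\in R^\oplus$: (1) for every $t_1$ with $m_1[t_1\rangle m_1'$, either (i) $t_1$ is $\tau$-sequential and there are $\tau$-sequential $\sigma$, $m_2'$ with $m_2[\sigma\rangle m_2'$, $\Psi({}^\bullet t_1,\sigma,R^\oplus)$, $({}^\bullet t_1,\sigma^\bullet)\in R^\oplus$, $(t_1^\bullet,\sigma^\bullet)\in R^\oplus$, $(m_1\ominus{}^\bullet t_1,m_2\ominus{}^\bullet\sigma)\in R^\oplus$; or (ii) there are $\tau$-sequential $\sigma$, $t_2\in T$, $m$, $m_2'$ with $m_2[\sigma\rangle m[t_2\rangle m_2'$, $\sigma^\bullet={}^\bullet t_2$, $l(t_1)=l(t_2)$, $\Psi({}^\bullet t_1,\sigma,R^\oplus)$, $({}^\bullet t_1,\sigma^\bullet)\in R^\oplus$, $(t_1^\bullet,t_2^\bullet)\in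 R^\oplus$, $(m_1\ominus{}^\bullet t_1,m_2\ominus{}^\bullet\sigma)\in R^\oplus$; (2) symmetrically for every $t_2$ with $m_2[t_2\rangle m_2'$: either (i) $t_2$ $\tau$-sequential and there are $\tau$-sequential $\sigma$, $m_1'$ with $m_1[\sigma\rangle m_1'$, $\Phi(\sigma,{}^\bullet t_2,R^\oplus)$, $(\sigma^\bullet,{}^\bullet t_2)\in R^\oplus$, $(\sigma^\bullet,t_2^\bullet)\in R^\oplus$, $(m_1\ominus{}^\bullet\sigma,m_2\ominus{}^\bullet t_2)\in R^\oplus$; or (ii) there are $\tau$-sequential $\sigma$, $t_1\in T$, $m$, $m_1'$ with $m_1[\sigma\rangle m[t_1\rangle m_1'$, $\sigma^\bullet={}^\bullet t_1$, $l(t_1)=l(t_2)$, $\Phi(\sigma,{}^\bullet t_2,R^\oplus)$, $(\sigma^\bullet,{}^\bullet t_2)\in R^\oplus$, $(t_1^\bullet,t_2^\bullet)\in R^\oplus$, $(m_1\ominus{}^\bullet\sigma,m_2\ominus{}^\bullet t_2)\in R^\oplus$. $m_1\approx_p m_2$ iff some branching place bisimulation $R$ has $(m_1,m_2)\in R^\oplus$. -}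

module Defs where

open import Data.Nat using (ℕ; _+_; _∸_; _≤_)
open import Data.Fin using (Fin; _≟_)
open import Data.Vec using (Vec; replicate; zipWith; sum; _[_]≔_)
open import Data.Vec.Relation.Binary.Pointwise.Inductive using (Pointwise)
open import Data.List using (List; []; _∷_; map; concat; foldr)
open import Data.List.Relation.Unary.All using (All)
open import Data.Product using (Σ; ∃; ∃-syntax; _×_; _,_)
open import Data.Sum using (_⊎_; inj₁; inj₂)
open import Relation.Nullary using (¬_; yes; no)
open import Relation.Binary.PropositionalEquality using (_≡_; _≢_)

Marking : ℕ → Set
Marking n = Vec ℕ n

module _ {n : ℕ} where

  θ : Marking n
  θ = replicate n 0

  infixl 6 _⊕_ _⊖_
  _⊕_ : Marking n → Marking n → Marking n
  _⊕_ = zipWith _+_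

  _⊖_ : Marking n → Marking n → Marking n
  _⊖_ = zipWith _∸_

  infix 4 _⊆_
  _⊆_ : Marking n → Marking n → Set
  _⊆_ = Pointwise _≤_

  ∣_∣ : Marking n → ℕ
  ∣ m ∣ = sum m

  ⟦_⟧ : Fin n → Marking n
  ⟦ s ⟧ = θ [ s ]≔ 1

  ⨁ : List (Marking n) → Marking n
  ⨁ = foldr _⊕_ θ

record Transition (nS nA : ℕ) : Set where
  constructor mkT
  field
    pre  : Marking nS
    lab  : Fin nA
    post : Marking nS
open Transition public

-- A P/T net N = (S, A, T) with silent moves:
--   S = Fin nS, A = Fin nA with τ ∈ A, T enumerated by Fin nT.
record Net : Set where
  field
    nS    : ℕ
    nA    : ℕ
    τ     : Fin nA
    nT    : ℕ
    trans : Fin nT → Transition nS nA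
    pre≢θ : ∀ i → pre (trans i) ≢ θ
open Net public

module WithNet (N : Net) where

  M : Set
  M = Marking (nS N)

  Tr : Set
  Tr = Transition (nS N) (nA N)

  idle : Fin (nS N) → Tr
  idle s = mkT ⟦ s ⟧ (τ N) ⟦ s ⟧

  -- elements of T ∪ I(S)
  step : Fin (nT N) ⊎ Fin (nS N) → Tr
  step (inj₁ i) = trans N i
  step (inj₂ s) = idle s

  _[_⟩_ : M → Tr → M → Set
  m [ t ⟩ m' = (pre t ⊆ m) × (m' ≡ (m ⊖ pre t) ⊕ post t)

  data _[_⟩*_ : M → List Tr → M → Set where
    fire-ε : ∀ {m} → m [ [] ⟩* m
    fire-∷ : ∀ {m m' m'' t σ} → m [ t ⟩ m' → m' [ σ ⟩* m'' → m [ t ∷ σ ⟩* m''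

  •_ : List Tr → M
  • []      = θ
  • (t ∷ σ) = pre t ⊕ ((• σ) ⊖ post t)

  _• : List Tr → M
  [] •      = θ
  (t ∷ σ) • = (σ •) ⊕ (post t ⊖ (• σ))

  o : List Tr → List (Fin (nA N))
  o []      = []
  o (t ∷ σ) with lab t ≟ τ N
  ... | yes _ = o σ
  ... | no  _ = lab t ∷ o σ

  seqT : List (Fin (nT N)) → List Tr
  seqT = map (trans N)

  IsBIB : (M → M → Set) → Set
  IsBIB R = ∀ m₁ m₂ → R m₁ m₂ →
      (∀ i m₁' → m₁ [ trans N i ⟩ m₁' →
          (lab (trans N i) ≡ τ N ×
             ∃[ σ₂ ] ∃[ m₂' ] (o (seqT σ₂) ≡ [] × m₂ [ seqT σ₂ ⟩* m₂'
                               × R m₁ m₂' × R m₁' m₂'))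
        ⊎ (∃[ σ ] ∃[ j ] ∃[ m ] ∃[ m₂' ]
             (o (seqT σ) ≡ [] × m₂ [ seqT σ ⟩* m × m [ trans N j ⟩ m₂'
              × lab (trans N i) ≡ lab (trans N j) × R m₁ m × R m₁' m₂')))
    × (∀ j m₂' → m₂ [ trans N j ⟩ m₂' →
          (lab (trans N j) ≡ τ N ×
             ∃[ σ₁ ] ∃[ m₁' ] (o (seqT σ₁) ≡ [] × m₁ [ seqT σ₁ ⟩* m₁'
                               × R m₁' m₂ × R m₁' m₂'))
        ⊎ (∃[ σ ] ∃[ i ] ∃[ m ] ∃[ m₁' ]
             (o (seqT σ) ≡ [] × m₁ [ seqT σ ⟩* m × m [ trans N i ⟩ m₁'
              × lab (trans N i) ≡ lab (trans N j) × R m m₂ × R m₁' m₂')))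

  _≈bri_ : M → M → Set₁
  m₁ ≈bri m₂ = Σ (M → M → Set) λ R → IsBIB R × R m₁ m₂

  τSeqTr : Tr → Set
  τSeqTr t = lab t ≡ τ N × ∣ pre t ∣ ≡ 1 × ∣ post t ∣ ≡ 1

  data τ1Seq : List Tr → Set where
    one  : ∀ {t} → τSeqTr t → τ1Seq (t ∷ [])
    more : ∀ {t t' σ} → τSeqTr t → post t ≡ pre t' → τ1Seq (t' ∷ σ) →
           τ1Seq (t ∷ t' ∷ σ)

  -- τ-k-sequential for some k ≥ 1
  τSeq : List Tr → Set
  τSeq σ = Σ (List (List Tr)) λ σs →
             (σs ≢ []) × All τ1Seq σs × σ ≡ concat σs
             × • σ ≡ ⨁ (map •_ σs) × σ • ≡ ⨁ (map _• σs)

  seqTI : List (Fin (nT N) ⊎ Fin (nS N)) → List Tr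
  seqTI = map step

  data Add (R : Fin (nS N) → Fin (nS N) → Set) : M → M → Set where
    add-θ : Add R θ θ
    add-s : ∀ {s₁ s₂ m₁ m₂ m₁' m₂'} → R s₁ s₂ → Add R m₁ m₂ →
            m₁' ≡ ⟦ s₁ ⟧ ⊕ m₁ → m₂' ≡ ⟦ s₂ ⟧ ⊕ m₂ → Add R m₁' m₂'

  -- markings m₀, …, m_{n-1} reached while firing σ from m₀
  visited : M → List Tr → List M
  visited m []      = []
  visited m (t ∷ σ) = m ∷ visited ((m ⊖ pre t) ⊕ post t) σ

  Ψ : M → List Tr → (M → M → Set) → Set
  Ψ m σ R⊕ = All (λ mᵢ → R⊕ m mᵢ) (visited (• σ) σ)

  Φ : List Tr → M → (M → M → Set) → Set
  Φ σ m R⊕ = All (λ mᵢ → R⊕ mᵢ m) (visited (• σ) σ)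

  IsBPB : (Fin (nS N) → Fin (nS N) → Set) → Set
  IsBPB R = ∀ m₁ m₂ → Add R m₁ m₂ →
      (∀ i m₁' → m₁ [ trans N i ⟩ m₁' →
         let t₁ = trans N i in
          (τSeqTr t₁ ×
             ∃[ σ ] ∃[ m₂' ] (τSeq (seqTI σ) × m₂ [ seqTI σ ⟩* m₂'
               × Ψ (pre t₁) (seqTI σ) (Add R)
               × Add R (pre t₁) (seqTI σ •)
               × Add R (post t₁) (seqTI σ •)
               × Add R (m₁ ⊖ pre t₁) (m₂ ⊖ • seqTI σ)))
        ⊎ (∃[ σ ] ∃[ j ] ∃[ m ] ∃[ m₂' ]
             (τSeq (seqTI σ) × m₂ [ seqTI σ ⟩* m × m [ trans N j ⟩ m₂'
               × seqTI σ • ≡ pre (trans N j)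
               × lab t₁ ≡ lab (trans N j)
               × Ψ (pre t₁) (seqTI σ) (Add R)
               × Add R (pre t₁) (seqTI σ •)
               × Add R (post t₁) (post (trans N j))
               × Add R (m₁ ⊖ pre t₁) (m₂ ⊖ • seqTI σ))))
    × (∀ j m₂' → m₂ [ trans N j ⟩ m₂' →
         let t₂ = trans N j in
          (τSeqTr t₂ ×
             ∃[ σ ] ∃[ m₁' ] (τSeq (seqTI σ) × m₁ [ seqTI σ ⟩* m₁'
               × Φ (seqTI σ) (pre t₂) (Add R)
               × Add R (seqTI σ •) (pre t₂)
               × Add R (seqTI σ •) (post t₂)
               × Add R (m₁ ⊖ • seqTI σ) (m₂ ⊖ pre t₂)))
        ⊎ (∃[ σ ] ∃[ i ] ∃[ m ] ∃[ m₁' ]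
             (τSeq (seqTI σ) × m₁ [ seqTI σ ⟩* m × m [ trans N i ⟩ m₁'
               × seqTI σ • ≡ pre (trans N i)
               × lab (trans N i) ≡ lab t₂
               × Φ (seqTI σ) (pre t₂) (Add R)
               × Add R (seqTI σ •) (pre t₂)
               × Add R (post (trans N i)) (post t₂)
               × Add R (m₁ ⊖ • seqTI σ) (m₂ ⊖ pre t₂))))

  _≈p_ : M → M → Set₁
  m₁ ≈p m₂ = Σ (Fin (nS N) → Fin (nS N) → Set) λ R → IsBPB R × Add R m₁ m₂

{-# OPTIONS --safe #-}
-- The additive closure R⊕ of a branching place bisimulation R is itself a
-- branching interleaving bisimulation. A τ-sequential computation used to
-- match a move is a silent firing sequence once its idling steps are erased,
-- and since R⊕ is closed under ⊕, relating the untouched residual markings and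
-- the matched presets (or postsets) relates the whole markings before (or after)
-- the moves.
module Submission where

open import Defs
open import Data.Nat using (ℕ; zero; suc; _+_; _∸_)
open import Data.Nat.Properties
  using ( +-assoc; +-comm; +-suc; +-identityˡ; +-identityʳ
        ; 0∸n≡0; ∸-+-assoc; m+n∸n≡m; m∸n+n≡m )
open import Data.Fin using (Fin; _≟_)
open import Data.Vec using ([]; _∷_)
open import Data.Vec.Properties using (zipWith-assoc; zipWith-identityˡ)
open import Data.Vec.Relation.Binary.Pointwise.Inductive using ([]; _∷_)
open import Data.List using (List; []; _∷_)
open import Data.List.Relation.Unary.All as All using (All; []; _∷_)
open import Data.List.Relation.Unary.All.Properties using (concat⁺)
open import Data.Product using (_,_; proj₁; proj₂)
open import Data.Sum using (_⊎_; inj₁; inj₂)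
open import Relation.Nullary using (yes; no; contradiction)
open import Relation.Binary.PropositionalEquality
  using (_≡_; refl; sym; cong; cong₂; subst; subst₂; module ≡-Reasoning)
  renaming (trans to ≡-trans)

private variable n : ℕ

x+q∸a+b≡x∸[a∸q]+[b+[q∸a]] : ∀ x q a b → x + q ∸ a + b ≡ x ∸ (a ∸ q) + (b + (q ∸ a))
x+q∸a+b≡x∸[a∸q]+[b+[q∸a]] x zero    a       b
  rewrite +-identityʳ x | 0∸n≡0 a | +-identityʳ b = refl
x+q∸a+b≡x∸[a∸q]+[b+[q∸a]] x (suc q) zero    b
  rewrite +-comm b (suc q) = +-assoc x (suc q) b
x+q∸a+b≡x∸[a∸q]+[b+[q∸a]] x (suc q) (suc a) b
  rewrite +-suc x q = x+q∸a+b≡x∸[a∸q]+[b+[q∸a]] x q a b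

⊕-assoc : (a b c : Marking n) → (a ⊕ b) ⊕ c ≡ a ⊕ (b ⊕ c)
⊕-assoc = zipWith-assoc +-assoc

⊕-identityˡ : (m : Marking n) → θ ⊕ m ≡ m
⊕-identityˡ = zipWith-identityˡ +-identityˡ

⊖θ⊕θ≡id : (m : Marking n) → (m ⊖ θ) ⊕ θ ≡ m
⊖θ⊕θ≡id []      = refl
⊖θ⊕θ≡id (x ∷ m) = cong₂ _∷_ (+-identityʳ x) (⊖θ⊕θ≡id m)

⊖-⊕-cancel : {p m : Marking n} → p ⊆ m → (m ⊖ p) ⊕ p ≡ m
⊖-⊕-cancel []          = refl
⊖-⊕-cancel (x≤y ∷ p⊆m) = cong₂ _∷_ (m∸n+n≡m x≤y) (⊖-⊕-cancel p⊆m)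

⊕-⊖-cancel : (a b : Marking n) → (a ⊕ b) ⊖ b ≡ a
⊕-⊖-cancel []      []      = refl
⊕-⊖-cancel (x ∷ a) (y ∷ b) = cong₂ _∷_ (m+n∸n≡m x y) (⊕-⊖-cancel a b)

⊖⊕⊖⊕-compose : (m p q a b : Marking n) →
               (((m ⊖ p) ⊕ q) ⊖ a) ⊕ b ≡ (m ⊖ (p ⊕ (a ⊖ q))) ⊕ (b ⊕ (q ⊖ a))
⊖⊕⊖⊕-compose []      []      []      []      []      = refl
⊖⊕⊖⊕-compose (x ∷ m) (y ∷ p) (z ∷ q) (u ∷ a) (v ∷ b) =
  cong₂ _∷_ (subst (λ w → x ∸ y + z ∸ u + v ≡ w + (v + (z ∸ u)))
                   (∸-+-assoc x y (u ∸ z))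
                   (x+q∸a+b≡x∸[a∸q]+[b+[q∸a]] (x ∸ y) z u v))
            (⊖⊕⊖⊕-compose m p q a b)

module _ (N : Net) where
  open WithNet N

  firing-effect : ∀ {m σ m'} → m [ σ ⟩* m' → m' ≡ (m ⊖ • σ) ⊕ (σ •)
  firing-effect {m} fire-ε = sym (⊖θ⊕θ≡id m)
  firing-effect {m} (fire-∷ {t = t} {σ = σ} (_ , refl) run) =
    ≡-trans (firing-effect run) (⊖⊕⊖⊕-compose m (pre t) (post t) (• σ) (σ •))

  firing-after : ∀ {m₀ σ m t m'} → m₀ [ σ ⟩* m → σ • ≡ pre t → m [ t ⟩ m' →
                 m' ≡ (m₀ ⊖ • σ) ⊕ post t
  firing-after {m₀} {σ} {m} {t} run σ•≡pre (_ , refl) = cong (_⊕ post t) (begin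
    m ⊖ pre t                     ≡⟨ cong (_⊖ pre t) (firing-effect run) ⟩
    ((m₀ ⊖ • σ) ⊕ (σ •)) ⊖ pre t  ≡⟨ cong (λ p → ((m₀ ⊖ • σ) ⊕ p) ⊖ pre t) σ•≡pre ⟩
    ((m₀ ⊖ • σ) ⊕ pre t) ⊖ pre t  ≡⟨ ⊕-⊖-cancel (m₀ ⊖ • σ) (pre t) ⟩
    m₀ ⊖ • σ                      ∎)
    where open ≡-Reasoning

  dropIdle : List (Fin (nT N) ⊎ Fin (nS N)) → List (Fin (nT N))
  dropIdle []           = []
  dropIdle (inj₁ i ∷ σ) = i ∷ dropIdle σ
  dropIdle (inj₂ _ ∷ σ) = dropIdle σ

  fire-dropIdle : ∀ σ {m m'} → m [ seqTI σ ⟩* m' → m [ seqT (dropIdle σ) ⟩* m'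
  fire-dropIdle []           fire-ε                   = fire-ε
  fire-dropIdle (inj₁ _ ∷ σ) (fire-∷ step run)        = fire-∷ step (fire-dropIdle σ run)
  fire-dropIdle (inj₂ _ ∷ σ) (fire-∷ (s⊆m , refl) run) =
    fire-dropIdle σ (subst (_[ seqTI σ ⟩* _) (⊖-⊕-cancel s⊆m) run)

  All-dropIdle : ∀ {P : Tr → Set} σ → All P (seqTI σ) → All P (seqT (dropIdle σ))
  All-dropIdle []           []         = []
  All-dropIdle (inj₁ _ ∷ σ) (pt ∷ pσ) = pt ∷ All-dropIdle σ pσ
  All-dropIdle (inj₂ _ ∷ σ) (_  ∷ pσ) = All-dropIdle σ pσ

  Silent : Tr → Set
  Silent t = lab t ≡ τ N

  τ1Seq⇒silent : ∀ {σ} → τ1Seq σ → All Silent σ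
  τ1Seq⇒silent (one (t-τ , _))      = t-τ ∷ []
  τ1Seq⇒silent (more (t-τ , _) _ σ) = t-τ ∷ τ1Seq⇒silent σ

  τSeq⇒silent : ∀ {σ} → τSeq σ → All Silent σ
  τSeq⇒silent (_ , _ , τ1Seq-σs , refl , _) = concat⁺ (All.map τ1Seq⇒silent τ1Seq-σs)

  silent⇒o≡[] : ∀ {σ} → All Silent σ → o σ ≡ []
  silent⇒o≡[]         []          = refl
  silent⇒o≡[] {t ∷ _} (t-τ ∷ σ-τ) with lab t ≟ τ N
  ... | yes _     = silent⇒o≡[] σ-τ
  ... | no  t-≢τ = contradiction t-τ t-≢τ

  τSeq⇒o-dropIdle≡[] : ∀ σ → τSeq (seqTI σ) → o (seqT (dropIdle σ)) ≡ []
  τSeq⇒o-dropIdle≡[] σ τσ = silent⇒o≡[] (All-dropIdle σ (τSeq⇒silent τσ))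

  module _ (R : Fin (nS N) → Fin (nS N) → Set) where

    Add-⊕ : ∀ {a₁ a₂ b₁ b₂} → Add R a₁ a₂ → Add R b₁ b₂ → Add R (a₁ ⊕ b₁) (a₂ ⊕ b₂)
    Add-⊕ {b₁ = b₁} {b₂} add-θ b₁Rb₂ =
      subst₂ (Add R) (sym (⊕-identityˡ b₁)) (sym (⊕-identityˡ b₂)) b₁Rb₂
    Add-⊕ {b₁ = b₁} {b₂} (add-s {s₁} {s₂} {a₁} {a₂} s₁Rs₂ a₁Ra₂ refl refl) b₁Rb₂ =
      add-s s₁Rs₂ (Add-⊕ a₁Ra₂ b₁Rb₂) (⊕-assoc ⟦ s₁ ⟧ a₁ b₁) (⊕-assoc ⟦ s₂ ⟧ a₂ b₂)

    Add-⊕-residual : ∀ {r₁ r₂ x₁ x₂ m₁ m₂} → Add R r₁ r₂ → Add R x₁ x₂ →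
                     m₁ ≡ r₁ ⊕ x₁ → m₂ ≡ r₂ ⊕ x₂ → Add R m₁ m₂
    Add-⊕-residual r₁Rr₂ x₁Rx₂ refl refl = Add-⊕ r₁Rr₂ x₁Rx₂

    IsBPB⇒IsBIB : IsBPB R → IsBIB (Add R)
    proj₁ (IsBPB⇒IsBIB bpb m₁ m₂ m₁Rm₂) i m₁' step@(pre⊆m₁ , m₁'≡)
      with proj₁ (bpb m₁ m₂ m₁Rm₂) i m₁' step
    ... | inj₁ ((t-τ , _) , σ , m₂' , τσ , run , _ , preRσ• , postRσ• , residual) =
      inj₁ (t-τ , dropIdle σ , m₂' , τSeq⇒o-dropIdle≡[] σ τσ , fire-dropIdle σ run ,
            Add-⊕-residual residual preRσ• (sym (⊖-⊕-cancel pre⊆m₁)) (firing-effect run) ,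
            Add-⊕-residual residual postRσ• m₁'≡ (firing-effect run))
    ... | inj₂ (σ , j , m , m₂' , τσ , run , fire-j , σ•≡pre , lab≡ , _ ,
                preRσ• , postRpost , residual) =
      inj₂ (dropIdle σ , j , m , m₂' , τSeq⇒o-dropIdle≡[] σ τσ , fire-dropIdle σ run ,
            fire-j , lab≡ ,
            Add-⊕-residual residual preRσ• (sym (⊖-⊕-cancel pre⊆m₁)) (firing-effect run) ,
            Add-⊕-residual residual postRpost m₁'≡
              (firing-after {t = trans N j} run σ•≡pre fire-j))
    proj₂ (IsBPB⇒IsBIB bpb m₁ m₂ m₁Rm₂) j m₂' step@(pre⊆m₂ , m₂'≡)
      with proj₂ (bpb m₁ m₂ m₁Rm₂) j m₂' step
    ... | inj₁ ((t-τ , _) , σ , m₁' , τσ , run , _ , σ•Rpre , σ•Rpost , residual) =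
      inj₁ (t-τ , dropIdle σ , m₁' , τSeq⇒o-dropIdle≡[] σ τσ , fire-dropIdle σ run ,
            Add-⊕-residual residual σ•Rpre (firing-effect run) (sym (⊖-⊕-cancel pre⊆m₂)) ,
            Add-⊕-residual residual σ•Rpost (firing-effect run) m₂'≡)
    ... | inj₂ (σ , i , m , m₁' , τσ , run , fire-i , σ•≡pre , lab≡ , _ ,
                σ•Rpre , postRpost , residual) =
      inj₂ (dropIdle σ , i , m , m₁' , τSeq⇒o-dropIdle≡[] σ τσ , fire-dropIdle σ run ,
            fire-i , lab≡ ,
            Add-⊕-residual residual σ•Rpre (firing-effect run) (sym (⊖-⊕-cancel pre⊆m₂)) ,
            Add-⊕-residual residual postRpost
              (firing-after {t = trans N i} run σ•≡pre fire-i) m₂'≡)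

proposition4p10 : (N : Net) (m₁ m₂ : WithNet.M N) →
    WithNet._≈p_ N m₁ m₂ → WithNet._≈bri_ N m₁ m₂
proposition4p10 N m₁ m₂ (R , bpb , m₁Rm₂) = WithNet.Add N R , IsBPB⇒IsBIB N R bpb , m₁Rm₂
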